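{- Let $f,g$ be systems with $\mathrm{Comp}(g)\subseteq\mathrm{Comp}(f)$, let $\sigma$ be an implementation of $g$ in $f$, and let $\mathcal{V}$ be a valuation. Then for all $x\in\mathrm{Beh}(f)$: (i) if $\alpha\in\mathcal{L}(\mathrm{Comp}(g))^\Box$ is positive and $g,\mathcal{V},\sigma(x)\models\alpha$, then $f,\mathcal{V},x\models\alpha$; (ii) if $\alpha\in\mathcal{L}(\mathrm{Comp}(g))^\Box$ is negative and $f,\mathcal{V},x\models\alpha$, then $g,\mathcal{V},\sigma(x)\models\alpha$.
   Context: Fix a collection $\mathbb{C}$ of basic components; each $c\in\mathbb{C}$ has a set $\mathrm{Beh}(c)$. For nonempty $C\subseteq\mathbb{C}$, $\mathrm{Beh}(C):=\prod_{c\in C}\mathrm{Beh}(c)$. A system is a function $f:B\to\mathrm{Beh}(C)$; $\mathrm{Beh}(f):=B$, $\mathrm{Comp}(f):=C$; $f_c$ ($c\in C$) is $f$ followed by projection onto $\mathrm{Beh}(c)$, similarly $f_D$. An implementation of $g$ in $f$ is a map $\sigma:\mathrm{Beh}(f)\to\mathrm{Beh}(g)$ with $f_{\mathrm{Comp}(g)}=g\circ\sigma$. Each $c\in\mathbb{C}$ has a set $Var(c)$ of variables (pairwise disjoint); a valuation $\mathcal{V}$ maps $p\in Var(c)$ to a subset of $\mathrm{Beh}(c)$. $\mathcal{L}(C)^\Box$ consists of formulas built from variables in $\bigcup_{c\in C}Var(c)$ with $\land$, $\lnot$ and a unary $\Box$, interpreted at $(f,\mathcal{V},x)$ with $\mathrm{Comp}(f)\supseteq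 C$, $x\in\mathrm{Beh}(f)$: $f,\mathcal{V},x\models p$ iff $f_c(x)\in\mathcal{V}(p)$ ($p\in Var(c)$); $\land,\lnot$ classical; $f,\mathcal{V},x\models\Box\varphi$ iff $f,\mathcal{V},y\models\varphi$ for all $y\in\mathrm{Beh}(f)$. A formula is positive (resp. negative) if no occurrence of $\Box$ lies in the scope of an odd (resp. even) number of $\lnot$'s. -}

module Defs where

open import Data.Bool using (Bool; T)
open import Data.Product using (Σ; _×_)
open import Data.Empty using (⊥)
import Data.Unit
open import Relation.Binary.PropositionalEquality using (_≡_)

-- The framework is parameterised by the collection of basic components 𝕔,
-- the behaviour sets Beh c, and the variable sets Var c (variables of
-- distinct components are disjoint since they are tagged by their component).
module Framework (𝕔 : Set) (Beh : 𝕔 → Set) (Var : 𝕔 → Set) where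

  CompSet : Set
  CompSet = 𝕔 → Bool

  _⊆_ : CompSet → CompSet → Set
  C ⊆ D = (c : 𝕔) → T (C c) → T (D c)

  NonEmpty : CompSet → Set
  NonEmpty C = Σ 𝕔 (λ c → T (C c))

  BehSet : CompSet → Set
  BehSet C = (c : 𝕔) → T (C c) → Beh c

  record System : Set₁ where
    field
      B        : Set
      Comp     : CompSet
      nonempty : NonEmpty Comp
      map      : B → BehSet Comp
  open System public

  proj : (f : System) (c : 𝕔) → T (Comp f c) → B f → Beh c
  proj f c p x = map f x c p

  IsImplementation : (f g : System) → Comp g ⊆ Comp f → (B f → B g) → Set
  IsImplementation f g inc σ =
    (x : B f) (c : 𝕔) (p : T (Comp g c)) → proj f c (inc c p) x ≡ proj g c p (σ x)

  Valuation : Set₁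
  Valuation = (c : 𝕔) → Var c → Beh c → Set

  data Form (C : CompSet) : Set where
    var  : (c : 𝕔) → T (C c) → Var c → Form C
    _∧_  : Form C → Form C → Form C
    ¬_   : Form C → Form C
    □_   : Form C → Form C

  Sat : {C : CompSet} (f : System) → C ⊆ Comp f → Valuation → B f → Form C → Set
  Sat f inc V x (var c q p) = V c p (proj f c (inc c q) x)
  Sat f inc V x (φ ∧ ψ)     = Sat f inc V x φ × Sat f inc V x ψ
  Sat f inc V x (¬ φ)       = Sat f inc V x φ → ⊥
  Sat f inc V x (□ φ)       = (y : B f) → Sat f inc V y φ

  -- positive: no □ under an odd number of ¬; negative: no □ under an even number of ¬
  mutual
    Positive : {C : CompSet} → Form C → Set
    Positive (var c q p) = Data.Unit.⊤
    Positive (φ ∧ ψ)     = Positive φ × Positive ψ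
    Positive (¬ φ)       = Negative φ
    Positive (□ φ)       = Positive φ

    Negative : {C : CompSet} → Form C → Set
    Negative (var c q p) = Data.Unit.⊤
    Negative (φ ∧ ψ)     = Negative φ × Negative ψ
    Negative (¬ φ)       = Positive φ
    Negative (□ φ)       = ⊥

  ⊆-refl : {C : CompSet} → C ⊆ C
  ⊆-refl c p = p

-- Atoms of L(Comp g) are evaluated through f_{Comp g} = g ∘ σ, so they hold at x in f
-- exactly when they hold at σ x in g. A □ at x in f quantifies over all of Beh(f),
-- whose image under σ is only part of Beh(g): truth of □φ transfers from g to f but
-- not back. Negation swaps the direction, hence positive formulas go up and negative
-- ones go down, by simultaneous induction.
module Submission where

open import Defs
open import Data.Product using (_×_; _,_)
open import Relation.Binary.PropositionalEquality using (subst; sym)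

module Implementation (𝕔 : Set) (Beh : 𝕔 → Set) (Var : 𝕔 → Set) where
  open Framework 𝕔 Beh Var

  module _ (f g : System) (inc : Comp g ⊆ Comp f) (σ : B f → B g)
           (impl : IsImplementation f g inc σ) (V : Valuation) where

    var-sat-↑ : ∀ x c q p → Sat g ⊆-refl V (σ x) (var c q p) → Sat f inc V x (var c q p)
    var-sat-↑ x c q p = subst (V c p) (sym (impl x c q))

    var-sat-↓ : ∀ x c q p → Sat f inc V x (var c q p) → Sat g ⊆-refl V (σ x) (var c q p)
    var-sat-↓ x c q p = subst (V c p) (impl x c q)

    mutual
      positive-sat-↑ : (x : B f) (α : Form (Comp g)) → Positive α →
                       Sat g ⊆-refl V (σ x) α → Sat f inc V x α
      positive-sat-↑ x (var c q p) _          = var-sat-↑ x c q p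
      positive-sat-↑ x (α ∧ β) (α⁺ , β⁺) (sα , sβ) =
        positive-sat-↑ x α α⁺ sα , positive-sat-↑ x β β⁺ sβ
      positive-sat-↑ x (¬ α) α⁻ ¬sα sα        = ¬sα (negative-sat-↓ x α α⁻ sα)
      positive-sat-↑ x (□ α) α⁺ □sα y         = positive-sat-↑ y α α⁺ (□sα (σ y))

      negative-sat-↓ : (x : B f) (α : Form (Comp g)) → Negative α →
                       Sat f inc V x α → Sat g ⊆-refl V (σ x) α
      negative-sat-↓ x (var c q p) _          = var-sat-↓ x c q p
      negative-sat-↓ x (α ∧ β) (α⁻ , β⁻) (sα , sβ) =
        negative-sat-↓ x α α⁻ sα , negative-sat-↓ x β β⁻ sβ
      negative-sat-↓ x (¬ α) α⁺ ¬sα sα        = ¬sα (positive-sat-↑ x α α⁺ sα)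
      negative-sat-↓ x (□ α) ()

lemma4 : (𝕔 : Set) (Beh : 𝕔 → Set) (Var : 𝕔 → Set) →
    let open Framework 𝕔 Beh Var in
    (f g : System) (inc : Comp g ⊆ Comp f) (σ : B f → B g) →
    IsImplementation f g inc σ → (V : Valuation) → (x : B f) →
    ((α : Form (Comp g)) → Positive α → Sat g ⊆-refl V (σ x) α → Sat f inc V x α)
    × ((α : Form (Comp g)) → Negative α → Sat f inc V x α → Sat g ⊆-refl V (σ x) α)
lemma4 𝕔 Beh Var f g inc σ impl V x =
  positive-sat-↑ f g inc σ impl V x , negative-sat-↓ f g inc σ impl V x
  where open Implementation 𝕔 Beh Var
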